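{- Let $\alpha$ and $\beta$ be finite (possibly empty) sequences of positive integers and let $G=\alpha\circledcirc\beta$ be the single-pitch mis\`ere \textsc{cricket pitch} position with the bumps of $\alpha$ to the left of the roller and the bumps of $\beta$ to its right. Write $o(\cdot)$ for the mis\`ere outcome class. \begin{enumerate} \item If $o(\alpha\circledcirc)=\mathcal{R}$ and $o(\circledcirc\beta)=\mathcal{L}$, then $o(G)=\mathcal{P}$. \item If $o(\alpha\circledcirc)=\mathcal{R}$ and $o(\circledcirc\beta)=\mathcal{N}$, then $o(G)=\mathcal{R}$. \item If $o(\alpha\circledcirc)=\mathcal{N}$ and $o(\circledcirc\beta)=\mathcal{L}$, then $o(G)=\mathcal{L}$. \end{enumerate}
   Context: \textsc{cricket pitch}: a position is a finite row of bumps (non-negative integers) with one roller placed between two bumps or at one end; it is written $a_m\,a_{m-1}\ldots a_1\circledcirc b_1\,b_2\ldots b_n$, where $\circledcirc$ is the roller, so $a_1$ and $b_1$ are the bumps adjacent to the roller. Left moves the roller to the left over any positive number of consecutive bumps; Right moves it to the right over any positive number of consecutive bumps. Each bump rolled over is reduced by $1$. A bump of value $0$ is no longer a bump and can no longer be rolled over (the roller cannot pass it). $\alpha\circledcirc$ denotes the position with the bumps of $\alpha$ to the left of the roller and nothing to its right, and $\circledcirc\beta$ the analogous position. Mis\`ere play: the player who cannot move on their turn wins. Outcome classes: $\mathcal{L}$ (Left wins whoever moves first), $\mathcal{R}$ (Right wins whoever moves first), $\mathcal{N}$ (the player moving first wins), $\mathcal{P}$ (the player moving second wins). -}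

module Defs where

open import Data.Nat using (ℕ; suc)
open import Data.List using (List; []; _∷_; reverse)
open import Data.Product using (_×_; _,_; ∃)
open import Relation.Nullary using (¬_)

-- A single-pitch position: (L , R) where L lists the bumps to the left of the
-- roller starting with the one adjacent to the roller (a₁ ∷ a₂ ∷ …), and R
-- lists the bumps to the right starting with the adjacent one (b₁ ∷ b₂ ∷ …).
-- Entries equal to 0 are flattened bumps: they stay in place and block the roller.
Pos : Set
Pos = List ℕ × List ℕ

data LeftMove : Pos → Pos → Set where
  one  : ∀ {a L R} → LeftMove (suc a ∷ L , R) (L , a ∷ R)
  more : ∀ {a L R G} → LeftMove (L , a ∷ R) G → LeftMove (suc a ∷ L , R) G

data RightMove : Pos → Pos → Set where
  one  : ∀ {b L R} → RightMove (L , suc b ∷ R) (b ∷ L , R)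
  more : ∀ {b L R G} → RightMove (b ∷ L , R) G → RightMove (L , suc b ∷ R) G

-- Misère play (a player unable to move on their turn wins).
-- LSecond G : Left, with Right to move in G, has a winning strategy.
-- (All plays are finite, so the inductive definitions capture winning strategies.)
data LFirst : Pos → Set
data LSecond : Pos → Set

data LFirst where
  noMove : ∀ {G} → (∀ G' → ¬ LeftMove G G') → LFirst G
  move   : ∀ {G G'} → LeftMove G G' → LSecond G' → LFirst G

data LSecond where
  respond : ∀ {G G'} → RightMove G G' → (∀ G'' → RightMove G G'' → LFirst G'') → LSecond G

data RFirst : Pos → Set
data RSecond : Pos → Set

data RFirst where
  noMove : ∀ {G} → (∀ G' → ¬ RightMove G G') → RFirst G
  move   : ∀ {G G'} → RightMove G G' → RSecond G' → RFirst G

data RSecond where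
  respond : ∀ {G G'} → LeftMove G G' → (∀ G'' → LeftMove G G'' → RFirst G'') → RSecond G

data Outcome : Set where
  𝓛 𝓡 𝓝 𝓟 : Outcome

_hasOutcome_ : Pos → Outcome → Set
G hasOutcome 𝓛 = LFirst G × LSecond G
G hasOutcome 𝓡 = RFirst G × RSecond G
G hasOutcome 𝓝 = LFirst G × RFirst G
G hasOutcome 𝓟 = LSecond G × RSecond G

-- α ⊚ β, with α and β written left to right as in the paper (α = a_m … a₁).
_⊚_ : List ℕ → List ℕ → Pos
α ⊚ β = reverse α , β

{-# OPTIONS --safe #-}
-- Call a side an odd run if the bumps the roller can reach on it are all odd.
-- Facing an odd run, every Right move leaves an even bump (possibly 0) just behind
-- the roller and an odd run ahead. When Left's side is blocked, or its reachable
-- odd bumps are followed by a positive even one, Left moving first either has no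
-- move or restores that situation: roll once over the even bump, roll over a
-- leading 1 (flattening it blocks Right), or roll once over a larger odd bump,
-- after which every Right reply gives a smaller instance or the situation itself.
-- Hence, when Right's side is an odd run, Left wins moving second if it is nonempty,
-- and Left wins moving first exactly when Left's side is not a nonempty odd run.
-- Mirroring, the outcomes of α⊚ and ⊚β determine which sides are odd runs.
module Submission where

open import Defs
open import Data.Nat using (ℕ; zero; suc; _+_; _<_)
open import Data.Nat.Properties using (+-assoc; +-commutativeSemigroup; <-trans; n<1+n; module ≤-Reasoning)
open import Data.Nat.Induction using (<-wellFounded)
open import Data.Nat.ListAction using (sum)
open import Data.List using (List; []; _∷_)
open import Data.List.Relation.Unary.All using (All)
open import Data.Product using (_×_; _,_; ∃; proj₂; swap)
open import Data.Sum using (_⊎_; inj₁; inj₂)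
open import Data.Empty using (⊥-elim)
open import Function using (_on_)
open import Induction.WellFounded using (Acc; acc; WellFounded)
open import Relation.Binary.Construct.On as On using ()
open import Relation.Binary.PropositionalEquality using (_≡_)
open import Relation.Nullary using (¬_)
open import Algebra.Properties.CommutativeSemigroup +-commutativeSemigroup using (x∙yz≈y∙xz)

private
  variable
    a : ℕ
    L R L′ R′ : List ℕ
    G G′ : Pos

data Even : ℕ → Set
data Odd : ℕ → Set

data Even where
  zero : Even zero
  suc  : Odd a → Even (suc a)

data Odd where
  suc : Even a → Odd (suc a)

even-or-odd : ∀ n → Even n ⊎ Odd n
even-or-odd zero = inj₁ zero
even-or-odd (suc n) with even-or-odd n
... | inj₁ e = inj₂ (suc e)
... | inj₂ o = inj₁ (suc o)

data Blocked : List ℕ → Set where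
  end  : Blocked []
  flat : Blocked (0 ∷ L)

data OddRun : List ℕ → Set where
  blocked : Blocked L → OddRun L
  _∷_     : Odd a → OddRun L → OddRun (a ∷ L)

data OddRun⁺ : List ℕ → Set where
  _∷_ : Odd a → OddRun L → OddRun⁺ (a ∷ L)

data EvenInRun : List ℕ → Set where
  here : Even (suc a) → EvenInRun (suc a ∷ L)
  _∷_  : Odd a → EvenInRun L → EvenInRun (a ∷ L)

oddRun⁺⇒oddRun : OddRun⁺ L → OddRun L
oddRun⁺⇒oddRun (o ∷ r) = o ∷ r

run-trichotomy : ∀ L → OddRun⁺ L ⊎ Blocked L ⊎ EvenInRun L
run-trichotomy [] = inj₂ (inj₁ end)
run-trichotomy (a ∷ L) with even-or-odd a | run-trichotomy L
... | inj₁ zero    | _                = inj₂ (inj₁ flat)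
... | inj₁ (suc o) | _                = inj₂ (inj₂ (here (suc o)))
... | inj₂ o       | inj₁ r           = inj₁ (o ∷ oddRun⁺⇒oddRun r)
... | inj₂ o       | inj₂ (inj₁ b)    = inj₁ (o ∷ blocked b)
... | inj₂ o       | inj₂ (inj₂ e)    = inj₂ (inj₂ (o ∷ e))

even⇒blocked⊎evenInRun : Even a → Blocked (a ∷ L) ⊎ EvenInRun (a ∷ L)
even⇒blocked⊎evenInRun zero    = inj₁ flat
even⇒blocked⊎evenInRun (suc o) = inj₂ (here (suc o))

blocked⇒¬LeftMove : Blocked L → ¬ LeftMove (L , R) G
blocked⇒¬LeftMove end  ()
blocked⇒¬LeftMove flat ()

blocked⇒¬RightMove : Blocked R → ¬ RightMove (L , R) G
blocked⇒¬RightMove end  ()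
blocked⇒¬RightMove flat ()

oddRun⁺⇒RightMove : OddRun⁺ R → ∃ (RightMove (L , R))
oddRun⁺⇒RightMove (suc _ ∷ _) = _ , one

rightMove-oddRun : OddRun R → RightMove (L , R) (L′ , R′) →
                   (Blocked L′ ⊎ EvenInRun L′) × OddRun R′
rightMove-oddRun (blocked b)   m        = ⊥-elim (blocked⇒¬RightMove b m)
rightMove-oddRun (suc e ∷ r)   one      = even⇒blocked⊎evenInRun e , r
rightMove-oddRun (suc _ ∷ r)   (more m) = rightMove-oddRun r m

height : Pos → ℕ
height (L , R) = sum L + sum R

_≺_ : Pos → Pos → Set
_≺_ = _<_ on height

≺-wellFounded : WellFounded _≺_
≺-wellFounded = On.wellFounded height <-wellFounded

height-∷ˡ : ∀ a L R → height (a ∷ L , R) ≡ a + height (L , R)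
height-∷ˡ a L R = +-assoc a (sum L) (sum R)

height-∷ʳ : ∀ a L R → height (L , a ∷ R) ≡ a + height (L , R)
height-∷ʳ a L R = x∙yz≈y∙xz (sum L) a (sum R)

leftStep-≺ : ∀ a L R → (L , a ∷ R) ≺ (suc a ∷ L , R)
leftStep-≺ a L R = begin-strict
  height (L , a ∷ R)     ≡⟨ height-∷ʳ a L R ⟩
  a + height (L , R)     <⟨ n<1+n _ ⟩
  suc a + height (L , R) ≡⟨ height-∷ˡ (suc a) L R ⟨
  height (suc a ∷ L , R) ∎
  where open ≤-Reasoning

rightStep-≺ : ∀ a L R → (a ∷ L , R) ≺ (L , suc a ∷ R)
rightStep-≺ a L R = begin-strict
  height (a ∷ L , R)     ≡⟨ height-∷ˡ a L R ⟩
  a + height (L , R)     <⟨ n<1+n _ ⟩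
  suc a + height (L , R) ≡⟨ height-∷ʳ (suc a) L R ⟨
  height (L , suc a ∷ R) ∎
  where open ≤-Reasoning

leftMove⇒≺ : LeftMove G G′ → G′ ≺ G
leftMove⇒≺ (one {a} {L} {R})    = leftStep-≺ a L R
leftMove⇒≺ (more {a} {L} {R} m) = <-trans (leftMove⇒≺ m) (leftStep-≺ a L R)

rightMove⇒≺ : RightMove G G′ → G′ ≺ G
rightMove⇒≺ (one {a} {L} {R})    = rightStep-≺ a L R
rightMove⇒≺ (more {a} {L} {R} m) = <-trans (rightMove⇒≺ m) (rightStep-≺ a L R)

mirror-LeftMove : LeftMove G G′ → RightMove (swap G) (swap G′)
mirror-LeftMove one      = one
mirror-LeftMove (more m) = more (mirror-LeftMove m)

mirror-RightMove : RightMove G G′ → LeftMove (swap G) (swap G′)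
mirror-RightMove one      = one
mirror-RightMove (more m) = more (mirror-RightMove m)

mirror-LFirst  : LFirst G → RFirst (swap G)
mirror-LSecond : LSecond G → RSecond (swap G)

mirror-LFirst (noMove stuck) = noMove λ G′ m → stuck (swap G′) (mirror-RightMove m)
mirror-LFirst (move m w)     = move (mirror-LeftMove m) (mirror-LSecond w)

mirror-LSecond (respond m w) =
  respond (mirror-RightMove m) λ G′ m′ → mirror-LFirst (w (swap G′) (mirror-LeftMove m′))

LFirst⇒¬RSecond : LFirst G → ¬ RSecond G
LSecond⇒¬RFirst : LSecond G → ¬ RFirst G

LFirst⇒¬RSecond (noMove stuck) (respond m _) = stuck _ m
LFirst⇒¬RSecond (move m w)     (respond _ r) = LSecond⇒¬RFirst w (r _ m)

LSecond⇒¬RFirst (respond m _) (noMove stuck) = stuck _ m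
LSecond⇒¬RFirst (respond _ w) (move m r)     = LFirst⇒¬RSecond (w _ m) r

LeftWinningMove : Pos → Set
LeftWinningMove G = ∃ λ G′ → LeftMove G G′ × LSecond G′

oddRun⁺⇒LSecond-acc : Acc _≺_ (L , R) → OddRun⁺ R → LSecond (L , R)
blocked⊎evenInRun⇒LFirst-acc : Acc _≺_ (L , R) → Blocked L ⊎ EvenInRun L → OddRun R → LFirst (L , R)
evenInRun⇒LeftWinningMove : Acc _≺_ (L , R) → EvenInRun L → OddRun R → LeftWinningMove (L , R)

oddRun⁺⇒LSecond-acc (acc rs) r = respond (oddRun⁺⇒RightMove r .proj₂) λ _ m →
  let l , r′ = rightMove-oddRun (oddRun⁺⇒oddRun r) m in
  blocked⊎evenInRun⇒LFirst-acc (rs (rightMove⇒≺ m)) l r′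

blocked⊎evenInRun⇒LFirst-acc _ (inj₁ b) _ = noMove λ _ → blocked⇒¬LeftMove b
blocked⊎evenInRun⇒LFirst-acc ac (inj₂ e) r =
  let _ , m , w = evenInRun⇒LeftWinningMove ac e r in move m w

evenInRun⇒LeftWinningMove {a ∷ L} {R} (acc rs) (here (suc o)) r =
  _ , one , oddRun⁺⇒LSecond-acc (rs (leftStep-≺ _ L R)) (o ∷ r)
evenInRun⇒LeftWinningMove {1 ∷ L} {R} (acc rs) (suc zero ∷ e) _ =
  let _ , m , w = evenInRun⇒LeftWinningMove (rs (leftStep-≺ 0 L R)) e (blocked flat) in
  _ , more m , w
evenInRun⇒LeftWinningMove {suc (suc k) ∷ L} {R} (acc rs) (suc (suc o) ∷ e) r =
  _ , one , respond one λ where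
    _ one      → blocked⊎evenInRun⇒LFirst-acc (rs (leftThenRight-≺ one)) (inj₂ (o ∷ e)) r
    _ (more m) → let l , r′ = rightMove-oddRun r m in
                 blocked⊎evenInRun⇒LFirst-acc (rs (leftThenRight-≺ (more m))) l r′
  where
  leftThenRight-≺ : RightMove (L , suc k ∷ R) G → G ≺ (suc (suc k) ∷ L , R)
  leftThenRight-≺ m = <-trans (rightMove⇒≺ m) (leftStep-≺ (suc k) L R)

oddRun⁺⇒LSecond : OddRun⁺ R → LSecond (L , R)
oddRun⁺⇒LSecond = oddRun⁺⇒LSecond-acc (≺-wellFounded _)

blocked⊎evenInRun⇒LFirst : Blocked L ⊎ EvenInRun L → OddRun R → LFirst (L , R)
blocked⊎evenInRun⇒LFirst = blocked⊎evenInRun⇒LFirst-acc (≺-wellFounded _)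

oddRun⁺⇒RSecond : OddRun⁺ L → RSecond (L , R)
oddRun⁺⇒RSecond l = mirror-LSecond (oddRun⁺⇒LSecond l)

blocked⊎evenInRun⇒RFirst : Blocked R ⊎ EvenInRun R → OddRun L → RFirst (L , R)
blocked⊎evenInRun⇒RFirst r l = mirror-LFirst (blocked⊎evenInRun⇒LFirst r l)

LFirst⇒blocked⊎evenInRun : LFirst (L , R) → Blocked L ⊎ EvenInRun L
LFirst⇒blocked⊎evenInRun {L} w with run-trichotomy L
... | inj₁ l = ⊥-elim (LFirst⇒¬RSecond w (oddRun⁺⇒RSecond l))
... | inj₂ l = l

RFirst⇒blocked⊎evenInRun : RFirst (L , R) → Blocked R ⊎ EvenInRun R
RFirst⇒blocked⊎evenInRun {R = R} w with run-trichotomy R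
... | inj₁ r = ⊥-elim (LSecond⇒¬RFirst (oddRun⁺⇒LSecond r) w)
... | inj₂ r = r

RSecond⇒oddRun⁺ : OddRun R → RSecond (L , R) → OddRun⁺ L
RSecond⇒oddRun⁺ {L = L} r w with run-trichotomy L
... | inj₁ l = l
... | inj₂ l = ⊥-elim (LFirst⇒¬RSecond (blocked⊎evenInRun⇒LFirst l r) w)

LSecond⇒oddRun⁺ : OddRun L → LSecond (L , R) → OddRun⁺ R
LSecond⇒oddRun⁺ {R = R} l w with run-trichotomy R
... | inj₁ r = r
... | inj₂ r = ⊥-elim (LSecond⇒¬RFirst w (blocked⊎evenInRun⇒RFirst r l))

theorem4 : (α β : List ℕ) → All (0 <_) α → All (0 <_) β →
    ((α ⊚ []) hasOutcome 𝓡 → ([] ⊚ β) hasOutcome 𝓛 → (α ⊚ β) hasOutcome 𝓟)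
    × ((α ⊚ []) hasOutcome 𝓡 → ([] ⊚ β) hasOutcome 𝓝 → (α ⊚ β) hasOutcome 𝓡)
    × ((α ⊚ []) hasOutcome 𝓝 → ([] ⊚ β) hasOutcome 𝓛 → (α ⊚ β) hasOutcome 𝓛)
theorem4 α β _ _ =
    (λ (_ , rα) (_ , lβ) →
       oddRun⁺⇒LSecond (LSecond⇒oddRun⁺ (blocked end) lβ) ,
       oddRun⁺⇒RSecond (RSecond⇒oddRun⁺ (blocked end) rα))
  , (λ (_ , rα) (_ , rβ) →
       let oα = RSecond⇒oddRun⁺ (blocked end) rα in
       blocked⊎evenInRun⇒RFirst (RFirst⇒blocked⊎evenInRun rβ) (oddRun⁺⇒oddRun oα) ,
       oddRun⁺⇒RSecond oα)
  , (λ (lα , _) (_ , lβ) →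
       let oβ = LSecond⇒oddRun⁺ (blocked end) lβ in
       blocked⊎evenInRun⇒LFirst (LFirst⇒blocked⊎evenInRun lα) (oddRun⁺⇒oddRun oβ) ,
       oddRun⁺⇒LSecond oβ)
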